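{- For every integer $n\ge 2$, $$v(n\text{ - }pl)=\sum_{j=1}^{n-1}A_j\,h_{n-1,j},\qquad\text{where }A_j=2j^2+j+1 .$$
   Context: For positive integers $n,m$ with $m\le n$, the Goodman–Savage number is $h_{n,m}=\sum_{r=0}^{m}(-1)^r\frac{(m-r)^n}{(m-r)!\,r!}$ (convention $0^0=1$). The Goodman–Fine number (Goodman's maximum primary complexity value of an $n$-place predicate) is defined by $$v(n\text{ - }pl)=\sum_{k=1}^{n}\sum_{r=0}^{k}(-1)^r\,(2k-1)\,\frac{(k-r)^n}{(k-r)!\,r!}.$$ -}

module Defs where

open import Data.Nat as ℕ using (ℕ; zero; suc; _∸_; _!)
open import Data.Nat.Properties using (_!*_!≢0)
open import Data.Integer as ℤ using (ℤ; +_)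
open import Data.Rational as ℚ using (ℚ; _/_; _+_; _*_; -_; 0ℚ; 1ℚ)

sumFrom : ℕ → ℕ → (ℕ → ℚ) → ℚ
sumFrom a zero    f = 0ℚ
sumFrom a (suc k) f = f a + sumFrom (suc a) k f

sumRange : ℕ → ℕ → (ℕ → ℚ) → ℚ
sumRange a b f = sumFrom a (suc b ∸ a) f

nq : ℕ → ℚ
nq k = + k / 1

sign : ℕ → ℚ
sign zero    = ℚ.1ℚ
sign (suc r) = - sign r

-- (m-r)^n / ((m-r)! r!)   (with ℕ exponentiation, so 0^0 = 1)
term : ℕ → ℕ → ℕ → ℚ
term n m r = _/_ (+ ((m ∸ r) ℕ.^ n)) ((m ∸ r) ! ℕ.* r !) {{(m ∸ r) !* r !≢0}}

h : ℕ → ℕ → ℚ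
h n m = sumRange 0 m (λ r → sign r * term n m r)

v : ℕ → ℚ
v n = sumRange 1 n (λ k → sumRange 0 k (λ r →
        sign r * (nq (2 ℕ.* k ∸ 1) * term n k r)))

A : ℕ → ℕ
A j = 2 ℕ.* (j ℕ.* j) ℕ.+ j ℕ.+ 1

-- h n m is the Stirling number S(n, m) of the second kind: it satisfies
-- h (p+1) (i+1) = (i+1) h p (i+1) + h p i and vanishes for p < m.  Expanding each term
-- of v n = Σₖ (2k-1) h n k by this recurrence and shifting the index in the second
-- half, h (n-1) j collects the coefficient (2j-1) j + (2j+1) = A j, while the boundary
-- terms h (n-1) n and h (n-1) 0 vanish.  The base case h 0 (j+1) = 0 of the vanishing
-- comes from the recurrence at p = 0, because h 1 (j+1) = h 0 j.
module Submission where

open import Defs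
open import Data.Nat using (ℕ; _≤_; _∸_)
open import Data.Rational using (ℚ; _*_)
open import Relation.Binary.PropositionalEquality using (_≡_)

open import Data.Nat as ℕ using (zero; suc; _!; _<_; z≤n; s≤s; NonZero)
import Data.Nat.Properties as ℕ
open import Data.Nat.Tactic.RingSolver using (solve-∀)
open import Data.Integer as ℤ using (+_)
import Data.Integer.Properties as ℤ
open import Data.Rational as ℚ using (_/_; _+_; -_; 0ℚ; 1ℚ; 1/_; toℚᵘ; mkℚ)
open import Data.Rational.Unnormalised as ℚᵘ using (mkℚᵘ; *≡*)
import Data.Rational.Properties as ℚ
import Data.Rational.Unnormalised.Properties as ℚᵘ
open import Data.Rational.Solver using (module +-*-Solver)
open +-*-Solver using (solve; _:=_; _:+_; _:*_; :-_)
import Data.Nat.Coprimality as Coprimality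
open import Relation.Binary.PropositionalEquality
  using (refl; sym; trans; cong; cong₂; module ≡-Reasoning)

a*d≡c*b⇒a/b≡c/d : ∀ a b c d .{{_ : NonZero b}} .{{_ : NonZero d}} →
                  a ℕ.* d ≡ c ℕ.* b → + a / b ≡ + c / d
a*d≡c*b⇒a/b≡c/d a (suc b) c (suc d) eq = ℚ.fromℚᵘ-cong {mkℚᵘ (+ a) b} {mkℚᵘ (+ c) d}
  (*≡* (trans (sym (ℤ.pos-* a (suc d))) (trans (cong +_ eq) (ℤ.pos-* c (suc b)))))

/-*-/ : ∀ a b c d .{{_ : NonZero b}} .{{_ : NonZero d}} →
        (+ a / b) * (+ c / d) ≡ (+ (a ℕ.* c) / (b ℕ.* d)) {{ℕ.m*n≢0 b d}}
/-*-/ a (suc b) c (suc d) = ℚ.toℚᵘ-injective (begin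
  toℚᵘ (+ a / suc b * (+ c / suc d))              ≈⟨ ℚ.toℚᵘ-homo-* (+ a / suc b) (+ c / suc d) ⟩
  toℚᵘ (+ a / suc b) ℚᵘ.* toℚᵘ (+ c / suc d)      ≈⟨ ℚᵘ.*-cong (ℚ.toℚᵘ-fromℚᵘ (mkℚᵘ (+ a) b))
                                                               (ℚ.toℚᵘ-fromℚᵘ (mkℚᵘ (+ c) d)) ⟩
  mkℚᵘ (+ a) b ℚᵘ.* mkℚᵘ (+ c) d                  ≈⟨ ℚᵘ.≃-reflexive (cong (λ z → mkℚᵘ z _) (sym (ℤ.pos-* a c))) ⟩
  mkℚᵘ (+ (a ℕ.* c)) _                            ≈⟨ ℚᵘ.≃-sym (ℚ.toℚᵘ-fromℚᵘ _) ⟩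
  toℚᵘ (+ (a ℕ.* c) / (suc b ℕ.* suc d))          ∎)
  where open ℚᵘ.≃-Reasoning

nq-*-/ : ∀ a x d .{{_ : NonZero d}} → nq a * (+ x / d) ≡ + (a ℕ.* x) / d
nq-*-/ a x d = trans (/-*-/ a 1 x d)
  (a*d≡c*b⇒a/b≡c/d (a ℕ.* x) (1 ℕ.* d) (a ℕ.* x) d {{ℕ.m*n≢0 1 d}} (cong (a ℕ.* x ℕ.*_) (sym (ℕ.*-identityˡ d))))

nq-*-/-cancel : ∀ m x b d .{{_ : NonZero b}} .{{_ : NonZero d}} →
                b ≡ m ℕ.* d → nq m * (+ x / b) ≡ + x / d
nq-*-/-cancel m x b d b≡m*d = trans (nq-*-/ m x b) (a*d≡c*b⇒a/b≡c/d (m ℕ.* x) b x d (begin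
  m ℕ.* x ℕ.* d     ≡⟨ rearrange m x d ⟩
  x ℕ.* (m ℕ.* d)   ≡⟨ cong (x ℕ.*_) (sym b≡m*d) ⟩
  x ℕ.* b           ∎))
  where open ≡-Reasoning
        rearrange : ∀ m x d → m ℕ.* x ℕ.* d ≡ x ℕ.* (m ℕ.* d)
        rearrange = solve-∀

nq-* : ∀ a b → nq (a ℕ.* b) ≡ nq a * nq b
nq-* a b = sym (nq-*-/ a b 1)

nq-+ : ∀ a b → nq (a ℕ.+ b) ≡ nq a + nq b
nq-+ a b = ℚ.toℚᵘ-injective (begin
  toℚᵘ (nq (a ℕ.+ b))               ≈⟨ ℚ.toℚᵘ-fromℚᵘ _ ⟩
  mkℚᵘ (+ (a ℕ.+ b)) 0              ≈⟨ ℚᵘ.≃-reflexive (cong (λ z → mkℚᵘ z 0)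
                                         (trans (ℤ.pos-+ a b) (sym (cong₂ ℤ._+_ (ℤ.*-identityʳ (+ a)) (ℤ.*-identityʳ (+ b)))))) ⟩
  mkℚᵘ (+ a) 0 ℚᵘ.+ mkℚᵘ (+ b) 0    ≈⟨ ℚᵘ.≃-sym (ℚᵘ.+-cong (ℚ.toℚᵘ-fromℚᵘ (mkℚᵘ (+ a) 0)) (ℚ.toℚᵘ-fromℚᵘ (mkℚᵘ (+ b) 0))) ⟩
  toℚᵘ (nq a) ℚᵘ.+ toℚᵘ (nq b)      ≈⟨ ℚᵘ.≃-sym (ℚ.toℚᵘ-homo-+ (nq a) (nq b)) ⟩
  toℚᵘ (nq a + nq b)                ∎)
  where open ℚᵘ.≃-Reasoning

∑ : ℕ → (ℕ → ℚ) → ℚ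
∑ zero    f = 0ℚ
∑ (suc k) f = f 0 + ∑ k (λ i → f (suc i))

∑-cong : ∀ k {f g : ℕ → ℚ} → (∀ i → i < k → f i ≡ g i) → ∑ k f ≡ ∑ k g
∑-cong zero    f≡g = refl
∑-cong (suc k) f≡g = cong₂ _+_ (f≡g 0 (s≤s z≤n)) (∑-cong k (λ i i<k → f≡g (suc i) (s≤s i<k)))

sumFrom≡∑ : ∀ a k f → sumFrom a k f ≡ ∑ k (λ i → f (a ℕ.+ i))
sumFrom≡∑ a zero    f = refl
sumFrom≡∑ a (suc k) f = cong₂ _+_ (cong f (sym (ℕ.+-identityʳ a)))
  (trans (sumFrom≡∑ (suc a) k f) (∑-cong k (λ i _ → cong f (sym (ℕ.+-suc a i)))))

∑-distrib-+ : ∀ k f g → ∑ k (λ i → f i + g i) ≡ ∑ k f + ∑ k g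
∑-distrib-+ zero    f g = sym (ℚ.+-identityˡ 0ℚ)
∑-distrib-+ (suc k) f g = trans
  (cong (_+_ (f 0 + g 0)) (∑-distrib-+ k (λ i → f (suc i)) (λ i → g (suc i))))
  (interchange (f 0) (g 0) (∑ k (λ i → f (suc i))) (∑ k (λ i → g (suc i))))
  where
  interchange : ∀ a b c d → (a + b) + (c + d) ≡ (a + c) + (b + d)
  interchange = solve 4 (λ a b c d → (a :+ b) :+ (c :+ d) := (a :+ c) :+ (b :+ d)) refl

∑-*-distribˡ : ∀ k c f → ∑ k (λ i → c * f i) ≡ c * ∑ k f
∑-*-distribˡ zero    c f = sym (ℚ.*-zeroʳ c)
∑-*-distribˡ (suc k) c f = trans (cong (_+_ (c * f 0)) (∑-*-distribˡ k c (λ i → f (suc i))))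
  (sym (ℚ.*-distribˡ-+ c (f 0) (∑ k (λ i → f (suc i)))))

∑-neg : ∀ k f → ∑ k (λ i → - f i) ≡ - ∑ k f
∑-neg zero    f = refl
∑-neg (suc k) f = trans (cong (_+_ (- f 0)) (∑-neg k (λ i → f (suc i))))
  (sym (ℚ.neg-distrib-+ (f 0) (∑ k (λ i → f (suc i)))))

∑-snoc : ∀ k f → ∑ (suc k) f ≡ ∑ k f + f k
∑-snoc zero    f = ℚ.+-comm (f 0) 0ℚ
∑-snoc (suc k) f = trans (cong (_+_ (f 0)) (∑-snoc k (λ i → f (suc i))))
  (sym (ℚ.+-assoc (f 0) (∑ k (λ i → f (suc i))) (f (suc k))))

∑-shift : ∀ k f g → f k ≡ 0ℚ → g 0 ≡ 0ℚ →
          ∑ (suc k) (λ i → f i + g i) ≡ ∑ k (λ i → f i + g (suc i))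
∑-shift k f g fk≡0 g0≡0 = begin
  ∑ (suc k) (λ i → f i + g i)                       ≡⟨ ∑-distrib-+ (suc k) f g ⟩
  ∑ (suc k) f + (g 0 + ∑ k (λ i → g (suc i)))       ≡⟨ cong₂ _+_ (∑-snoc k f) (cong (_+ ∑ k (λ i → g (suc i))) g0≡0) ⟩
  (∑ k f + f k) + (0ℚ + ∑ k (λ i → g (suc i)))      ≡⟨ cong (λ z → (∑ k f + z) + (0ℚ + ∑ k (λ i → g (suc i)))) fk≡0 ⟩
  (∑ k f + 0ℚ) + (0ℚ + ∑ k (λ i → g (suc i)))       ≡⟨ cong₂ _+_ (ℚ.+-identityʳ (∑ k f)) (ℚ.+-identityˡ _) ⟩
  ∑ k f + ∑ k (λ i → g (suc i))                     ≡⟨ sym (∑-distrib-+ k f (λ i → g (suc i))) ⟩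
  ∑ k (λ i → f i + g (suc i))                       ∎
  where open ≡-Reasoning

h≡∑ : ∀ n m → h n m ≡ ∑ (suc m) (λ r → sign r * term n m r)
h≡∑ n m = sumFrom≡∑ 0 (suc m) (λ r → sign r * term n m r)

term-suc : ∀ p k r → term (suc p) k r ≡ nq (k ∸ r) * term p k r
term-suc p k r = sym (nq-*-/ (k ∸ r) ((k ∸ r) ℕ.^ p) ((k ∸ r) ! ℕ.* r !) {{(k ∸ r) ℕ.!* r !≢0}})

term-suc-diagonal : ∀ p k → term (suc p) k k ≡ 0ℚ
term-suc-diagonal p k = trans (term-suc p k k)
  (trans (cong (λ c → nq c * term p k k) (ℕ.n∸n≡0 k)) (ℚ.*-zeroˡ (term p k k)))

nq-suc-*-term-suc-suc : ∀ p i s → nq (suc s) * term p (suc i) (suc s) ≡ term p i s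
nq-suc-*-term-suc-suc p i s = nq-*-/-cancel (suc s) ((i ∸ s) ℕ.^ p)
  ((i ∸ s) ! ℕ.* suc s !) ((i ∸ s) ! ℕ.* s !) {{(i ∸ s) ℕ.!* suc s !≢0}} {{(i ∸ s) ℕ.!* s !≢0}}
  (left-comm ((i ∸ s) !) (suc s) (s !))
  where left-comm : ∀ a b c → a ℕ.* (b ℕ.* c) ≡ b ℕ.* (a ℕ.* c)
        left-comm = solve-∀

nq-*-h≡h-suc-h : ∀ p i → nq (suc i) * h p (suc i) ≡ h (suc p) (suc i) + - h p i
nq-*-h≡h-suc-h p i = begin
  nq k * h p k                                          ≡⟨ cong (nq k *_) (h≡∑ p k) ⟩
  nq k * ∑ (suc k) f                                    ≡⟨ sym (∑-*-distribˡ (suc k) (nq k) f) ⟩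
  ∑ (suc k) (λ r → nq k * f r)                          ≡⟨ ∑-cong (suc k) (λ r r<1+k → split r (ℕ.≤-pred r<1+k)) ⟩
  ∑ (suc k) (λ r → sign r * term (suc p) k r + g r)     ≡⟨ ∑-distrib-+ (suc k) (λ r → sign r * term (suc p) k r) g ⟩
  ∑ (suc k) (λ r → sign r * term (suc p) k r) + (g 0 + ∑ k (λ s → g (suc s)))
                                                        ≡⟨ cong₂ _+_ (sym (h≡∑ (suc p) k)) (cong₂ _+_ g0≡0 ∑g≡-h) ⟩
  h (suc p) k + (0ℚ + - h p i)                          ≡⟨ cong (_+_ (h (suc p) k)) (ℚ.+-identityˡ (- h p i)) ⟩
  h (suc p) k + - h p i                                 ∎
  where
  open ≡-Reasoning
  k = suc i
  f g : ℕ → ℚ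
  f r = sign r * term p k r
  g r = sign r * (nq r * term p k r)

  split : ∀ r → r ≤ k → nq k * f r ≡ sign r * term (suc p) k r + g r
  split r r≤k = begin
    nq k * (sign r * term p k r)                        ≡⟨ cong (λ c → nq c * f r) (sym (ℕ.m∸n+n≡m r≤k)) ⟩
    nq (k ∸ r ℕ.+ r) * (sign r * term p k r)            ≡⟨ cong (_* f r) (nq-+ (k ∸ r) r) ⟩
    (nq (k ∸ r) + nq r) * (sign r * term p k r)         ≡⟨ distribute (nq (k ∸ r)) (nq r) (sign r) (term p k r) ⟩
    sign r * (nq (k ∸ r) * term p k r) + g r            ≡⟨ cong (λ t → sign r * t + g r) (sym (term-suc p k r)) ⟩
    sign r * term (suc p) k r + g r                     ∎
    where
    distribute : ∀ a b s t → (a + b) * (s * t) ≡ s * (a * t) + s * (b * t)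
    distribute = solve 4 (λ a b s t → (a :+ b) :* (s :* t) := s :* (a :* t) :+ s :* (b :* t)) refl

  g0≡0 : g 0 ≡ 0ℚ
  g0≡0 = trans (cong (1ℚ *_) (ℚ.*-zeroˡ (term p k 0))) (ℚ.*-zeroʳ 1ℚ)

  ∑g≡-h : ∑ k (λ s → g (suc s)) ≡ - h p i
  ∑g≡-h = begin
    ∑ k (λ s → - sign s * (nq (suc s) * term p k (suc s)))
                                              ≡⟨ ∑-cong k (λ s _ → trans (cong (- sign s *_) (nq-suc-*-term-suc-suc p i s))
                                                                         (sym (ℚ.neg-distribˡ-* (sign s) (term p i s)))) ⟩
    ∑ k (λ s → - (sign s * term p i s))       ≡⟨ ∑-neg k (λ s → sign s * term p i s) ⟩
    - ∑ k (λ s → sign s * term p i s)         ≡⟨ cong -_ (sym (h≡∑ p i)) ⟩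
    - h p i                                   ∎

h-suc-suc : ∀ p i → h (suc p) (suc i) ≡ nq (suc i) * h p (suc i) + h p i
h-suc-suc p i = begin
  h (suc p) (suc i)                           ≡⟨ rearrange (h (suc p) (suc i)) (h p i) ⟩
  h (suc p) (suc i) + - h p i + h p i         ≡⟨ cong (_+ h p i) (sym (nq-*-h≡h-suc-h p i)) ⟩
  nq (suc i) * h p (suc i) + h p i            ∎
  where
  open ≡-Reasoning
  rearrange : ∀ x y → x ≡ x + - y + y
  rearrange = solve 2 (λ x y → x := x :+ :- y :+ y) refl

h-suc-zero : ∀ q → h (suc q) 0 ≡ 0ℚ
h-suc-zero q = refl

h-one-suc : ∀ j → h 1 (suc j) ≡ h 0 j
h-one-suc j = begin
  h 1 (suc j)                                           ≡⟨ h≡∑ 1 (suc j) ⟩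
  ∑ (suc (suc j)) f                                     ≡⟨ ∑-snoc (suc j) f ⟩
  ∑ (suc j) f + f (suc j)                               ≡⟨ cong₂ _+_ (∑-cong (suc j) (λ r r<1+j → cong (sign r *_) (term-one r (ℕ.≤-pred r<1+j))))
                                                                     (trans (cong (sign (suc j) *_) (term-suc-diagonal 0 (suc j))) (ℚ.*-zeroʳ (sign (suc j)))) ⟩
  ∑ (suc j) (λ r → sign r * term 0 j r) + 0ℚ            ≡⟨ ℚ.+-identityʳ _ ⟩
  ∑ (suc j) (λ r → sign r * term 0 j r)                 ≡⟨ sym (h≡∑ 0 j) ⟩
  h 0 j                                                 ∎
  where
  open ≡-Reasoning
  f : ℕ → ℚ
  f r = sign r * term 1 (suc j) r

  term-one : ∀ r → r ≤ j → term 1 (suc j) r ≡ term 0 j r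
  term-one r r≤j = begin
    term 1 (suc j) r                                    ≡⟨ term-suc 0 (suc j) r ⟩
    nq (suc j ∸ r) * term 0 (suc j) r                   ≡⟨ cong (λ c → nq c * (+ 1 / (c ! ℕ.* r !)) {{c ℕ.!* r !≢0}}) (ℕ.+-∸-assoc 1 r≤j) ⟩
    nq (suc c) * (+ 1 / (suc c ! ℕ.* r !)) {{suc c ℕ.!* r !≢0}}
                                                        ≡⟨ nq-*-/-cancel (suc c) 1 (suc c ! ℕ.* r !) (c ! ℕ.* r !)
                                                             {{suc c ℕ.!* r !≢0}} {{c ℕ.!* r !≢0}} (ℕ.*-assoc (suc c) (c !) (r !)) ⟩
    term 0 j r                                          ∎
    where c = j ∸ r

nonZero-*-≡0 : ∀ p .{{_ : ℚ.NonZero p}} q → p * q ≡ 0ℚ → q ≡ 0ℚ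
nonZero-*-≡0 p q p*q≡0 = begin
  q                     ≡⟨ sym (ℚ.*-identityˡ q) ⟩
  1ℚ * q                ≡⟨ cong (_* q) (sym (ℚ.*-inverseˡ p)) ⟩
  1/ p * p * q          ≡⟨ ℚ.*-assoc (1/ p) p q ⟩
  1/ p * (p * q)        ≡⟨ cong (1/ p *_) p*q≡0 ⟩
  1/ p * 0ℚ             ≡⟨ ℚ.*-zeroʳ (1/ p) ⟩
  0ℚ                    ∎
  where open ≡-Reasoning

nq-suc-*-≡0 : ∀ j q → nq (suc j) * q ≡ 0ℚ → q ≡ 0ℚ
nq-suc-*-≡0 j q eq = nonZero-*-≡0 (mkℚ (+ suc j) 0 coprime) q
  (trans (cong (_* q) (sym (ℚ.normalize-coprime coprime))) eq)
  where coprime = Coprimality.sym (Coprimality.1-coprimeTo (suc j))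

h-zero-suc : ∀ j → h 0 (suc j) ≡ 0ℚ
h-zero-suc j = nq-suc-*-≡0 j (h 0 (suc j)) (begin
  nq (suc j) * h 0 (suc j)      ≡⟨ nq-*-h≡h-suc-h 0 j ⟩
  h 1 (suc j) + - h 0 j         ≡⟨ cong (_+ - h 0 j) (h-one-suc j) ⟩
  h 0 j + - h 0 j               ≡⟨ ℚ.+-inverseʳ (h 0 j) ⟩
  0ℚ                            ∎)
  where open ≡-Reasoning

p<m⇒h≡0 : ∀ {p m} → p < m → h p m ≡ 0ℚ
p<m⇒h≡0 {zero}  {suc j} _          = h-zero-suc j
p<m⇒h≡0 {suc p} {suc j} (s≤s p<j) = begin
  h (suc p) (suc j)                     ≡⟨ h-suc-suc p j ⟩
  nq (suc j) * h p (suc j) + h p j      ≡⟨ cong₂ (λ a b → nq (suc j) * a + b) (p<m⇒h≡0 (ℕ.m<n⇒m<1+n p<j)) (p<m⇒h≡0 p<j) ⟩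
  nq (suc j) * 0ℚ + 0ℚ                  ≡⟨ trans (ℚ.+-identityʳ _) (ℚ.*-zeroʳ (nq (suc j))) ⟩
  0ℚ                                    ∎
  where open ≡-Reasoning

oddℚ : ℕ → ℚ
oddℚ k = nq (2 ℕ.* k ∸ 1)

v≡∑ : ∀ n → v n ≡ ∑ n (λ i → oddℚ (suc i) * h n (suc i))
v≡∑ n = trans (sumFrom≡∑ 1 n (λ k → sumRange 0 k (λ r → sign r * (oddℚ k * term n k r)))) (∑-cong n (λ i _ → inner (suc i)))
  where
  inner : ∀ k → sumRange 0 k (λ r → sign r * (oddℚ k * term n k r)) ≡ oddℚ k * h n k
  inner k = begin
    sumRange 0 k (λ r → sign r * (oddℚ k * term n k r))   ≡⟨ sumFrom≡∑ 0 (suc k) (λ r → sign r * (oddℚ k * term n k r)) ⟩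
    ∑ (suc k) (λ r → sign r * (oddℚ k * term n k r))       ≡⟨ ∑-cong (suc k) (λ r _ → left-comm (sign r) (oddℚ k) (term n k r)) ⟩
    ∑ (suc k) (λ r → oddℚ k * (sign r * term n k r))       ≡⟨ ∑-*-distribˡ (suc k) (oddℚ k) (λ r → sign r * term n k r) ⟩
    oddℚ k * ∑ (suc k) (λ r → sign r * term n k r)         ≡⟨ cong (oddℚ k *_) (sym (h≡∑ n k)) ⟩
    oddℚ k * h n k                                         ∎
    where
    open ≡-Reasoning
    left-comm : ∀ a b c → a * (b * c) ≡ b * (a * c)
    left-comm = solve 3 (λ a b c → a :* (b :* c) := b :* (a :* c)) refl

oddℚ-suc : ∀ i → oddℚ (suc i) ≡ nq (suc (2 ℕ.* i))
oddℚ-suc i = cong (λ m → nq (m ∸ 1)) (ℕ.*-suc 2 i)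

A-suc : ∀ i → nq (A (suc i)) ≡ oddℚ (suc i) * nq (suc i) + oddℚ (suc (suc i))
A-suc i = begin
  nq (A (suc i))                                            ≡⟨ cong nq (polynomial-identity i) ⟩
  nq (suc (2 ℕ.* i) ℕ.* suc i ℕ.+ suc (2 ℕ.* suc i))        ≡⟨ nq-+ (suc (2 ℕ.* i) ℕ.* suc i) (suc (2 ℕ.* suc i)) ⟩
  nq (suc (2 ℕ.* i) ℕ.* suc i) + nq (suc (2 ℕ.* suc i))     ≡⟨ cong (_+ nq (suc (2 ℕ.* suc i))) (nq-* (suc (2 ℕ.* i)) (suc i)) ⟩
  nq (suc (2 ℕ.* i)) * nq (suc i) + nq (suc (2 ℕ.* suc i))  ≡⟨ sym (cong₂ (λ x y → x * nq (suc i) + y) (oddℚ-suc i) (oddℚ-suc (suc i))) ⟩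
  oddℚ (suc i) * nq (suc i) + oddℚ (suc (suc i))            ∎
  where
  open ≡-Reasoning
  polynomial-identity : ∀ i → 2 ℕ.* (suc i ℕ.* suc i) ℕ.+ suc i ℕ.+ 1
                            ≡ suc (2 ℕ.* i) ℕ.* suc i ℕ.+ suc (2 ℕ.* suc i)
  polynomial-identity = solve-∀

proposition3 : (n : ℕ) → 2 ≤ n →
    v n ≡ sumRange 1 (n ∸ 1) (λ j → nq (A j) * h (n ∸ 1) j)
proposition3 (suc zero) (s≤s ())
proposition3 (suc (suc q)) _ = begin
  v (suc p)                                                       ≡⟨ v≡∑ (suc p) ⟩
  ∑ (suc p) (λ i → oddℚ (suc i) * h (suc p) (suc i))              ≡⟨ ∑-cong (suc p) (λ i _ → expand i) ⟩
  ∑ (suc p) (λ i → a i + oddℚ (suc i) * h p i)                    ≡⟨ ∑-shift p a (λ i → oddℚ (suc i) * h p i) a[p]≡0 bottom ⟩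
  ∑ p (λ i → a i + oddℚ (suc (suc i)) * h p (suc i))              ≡⟨ ∑-cong p (λ i _ → collect i) ⟩
  ∑ p (λ i → nq (A (suc i)) * h p (suc i))                        ≡⟨ sym (sumFrom≡∑ 1 p (λ j → nq (A j) * h p j)) ⟩
  sumRange 1 p (λ j → nq (A j) * h p j)                           ∎
  where
  open ≡-Reasoning
  p = suc q
  a : ℕ → ℚ
  a i = oddℚ (suc i) * nq (suc i) * h p (suc i)
  expand : ∀ i → oddℚ (suc i) * h (suc p) (suc i) ≡ a i + oddℚ (suc i) * h p i
  expand i = trans (cong (oddℚ (suc i) *_) (h-suc-suc p i))
    (solve 4 (λ w m x y → w :* (m :* x :+ y) := w :* m :* x :+ w :* y) refl (oddℚ (suc i)) (nq (suc i)) (h p (suc i)) (h p i))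
  bottom : oddℚ 1 * h p 0 ≡ 0ℚ
  bottom = trans (cong (oddℚ 1 *_) (h-suc-zero q)) (ℚ.*-zeroʳ (oddℚ 1))
  a[p]≡0 : a p ≡ 0ℚ
  a[p]≡0 = trans (cong (oddℚ (suc p) * nq (suc p) *_) (p<m⇒h≡0 (ℕ.n<1+n p))) (ℚ.*-zeroʳ (oddℚ (suc p) * nq (suc p)))
  collect : ∀ i → a i + oddℚ (suc (suc i)) * h p (suc i) ≡ nq (A (suc i)) * h p (suc i)
  collect i = trans (sym (ℚ.*-distribʳ-+ (h p (suc i)) (oddℚ (suc i) * nq (suc i)) (oddℚ (suc (suc i))))) (cong (_* h p (suc i)) (sym (A-suc i)))
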